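{- Let $p$ be a prime, $k\ge1$, $A=\mathbb{Z}_p^k$, and let $T$ be a caterpillar with spine path $s_1s_2s_3$, where $X$, $Y$, $Z$ denote the sets of leaves attached to $s_1$, $s_2$, $s_3$ respectively, and $|V(T)|=|A|$. Let $f$ be an $A$-rainbow labeling of $T$ with $f(s_1)=a$, $f(s_2)=0$, $f(s_3)=b$. Then: (i) there is no $u\in X$ with $f(u)=b-a$; (ii) there is no $w\in Z$ with $f(w)=a-b$; (iii) there are no $u\in X$, $v\in Y$ with $f(v)=f(u)+a$; (iv) there are no $w\in Z$, $v\in Y$ with $f(v)=f(w)+b$; (v) there are no $w\in Z$, $u\in X$ with $f(u)=f(w)+(b-a)$.
   Context: For an Abelian group $A$ and a tree $T$ with $|V(T)|=|A|$, a labeling $f\colon V(T)\to A$ induces the edge labeling $uv\mapsto f(u)+f(v)$; $f$ is an $A$-rainbow labeling if $f$ is a bijection and all edges receive distinct labels. -}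

module Defs where

open import Data.Nat using (ℕ; zero; suc; NonZero; _∸_)
import Data.Nat as ℕ
open import Data.Nat.DivMod using (_mod_)
open import Data.Fin using (Fin; toℕ)
open import Data.Vec using (Vec; zipWith; map; replicate)
open import Data.Product using (_×_; _,_)

ℤ^ : ℕ → ℕ → Set
ℤ^ p k = Vec (Fin p) k

module _ {p : ℕ} .{{_ : NonZero p}} where

  _+ₚ_ : Fin p → Fin p → Fin p
  i +ₚ j = (toℕ i ℕ.+ toℕ j) mod p

  -ₚ_ : Fin p → Fin p
  -ₚ i = (p ∸ toℕ i) mod p

  0ₚ : Fin p
  0ₚ = 0 mod p

  module _ {k : ℕ} where

    infixl 6 _⊕_ _⊖_

    _⊕_ : ℤ^ p k → ℤ^ p k → ℤ^ p k
    _⊕_ = zipWith _+ₚ_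

    ⊖_ : ℤ^ p k → ℤ^ p k
    ⊖_ = map -ₚ_

    _⊖_ : ℤ^ p k → ℤ^ p k → ℤ^ p k
    x ⊖ y = x ⊕ (⊖ y)

    𝟘 : ℤ^ p k
    𝟘 = replicate k 0ₚ


data Vtx (x y z : ℕ) : Set where
  s₁ s₂ s₃ : Vtx x y z
  leafX : Fin x → Vtx x y z
  leafY : Fin y → Vtx x y z
  leafZ : Fin z → Vtx x y z

data Edge (x y z : ℕ) : Set where
  e₁₂ e₂₃ : Edge x y z
  eX : Fin x → Edge x y z
  eY : Fin y → Edge x y z
  eZ : Fin z → Edge x y z

ends : ∀ {x y z} → Edge x y z → Vtx x y z × Vtx x y z
ends e₁₂    = s₁ , s₂
ends e₂₃    = s₂ , s₃
ends (eX i) = s₁ , leafX i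
ends (eY i) = s₂ , leafY i
ends (eZ i) = s₃ , leafZ i

∣V∣ : ℕ → ℕ → ℕ → ℕ
∣V∣ x y z = 3 ℕ.+ x ℕ.+ y ℕ.+ z

module _ {p : ℕ} .{{_ : NonZero p}} {k x y z : ℕ} where

  open import Data.Product using (proj₁; proj₂)
  open import Function.Definitions using (Bijective; Injective)
  open import Relation.Binary.PropositionalEquality using (_≡_)

  edgeLabel : (Vtx x y z → ℤ^ p k) → Edge x y z → ℤ^ p k
  edgeLabel f e = f (proj₁ (ends e)) ⊕ f (proj₂ (ends e))

  IsRainbow : (Vtx x y z → ℤ^ p k) → Set
  IsRainbow f = Bijective _≡_ _≡_ f × Injective _≡_ _≡_ (edgeLabel f)

-- Only injectivity of the edge labelling and the abelian group laws of ℤ_p^k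
-- are needed: in each of the five situations the leaf-edge in question would
-- receive the same label as another edge, because f(s₂) = 0 makes the labels
-- of e₁₂, e₂₃ and of the edges at s₂ equal to a, b and the leaf values.
module Submission where

open import Defs
open import Algebra.Bundles using (AbelianGroup)
open import Algebra.Structures using (IsAbelianGroup)
open import Algebra.Consequences.Propositional using (comm∧idʳ⇒id; comm∧invʳ⇒inv)
import Algebra.Properties.AbelianGroup as AbelianGroupProperties
import Algebra.Properties.CommutativeSemigroup as CommutativeSemigroupProperties
open import Data.Nat using (ℕ; NonZero; _^_; _≥_; _+_; _∸_; _%_; >-nonZero⁻¹)
open import Data.Nat.Properties using (+-comm; +-assoc; +-identityʳ; m∸n+n≡m; <⇒≤)
open import Data.Nat.DivMod using (_mod_; %-distribˡ-+; m%n%n≡m%n; m<n⇒m%n≡m; n%n≡0)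
open import Data.Nat.Primality using (Prime)
open import Data.Fin using (Fin; toℕ)
open import Data.Fin.Properties using (toℕ-fromℕ<; toℕ-injective; toℕ<n)
open import Data.Vec using (zipWith; map; replicate)
open import Data.Vec.Properties
  using (zipWith-comm; zipWith-assoc; zipWith-identityˡ; zipWith-identityʳ; zipWith-inverseˡ; zipWith-inverseʳ)
open import Data.Product using (_×_; ∃; ∃₂; _,_)
open import Function using (_∘_)
open import Level using (0ℓ)
open import Relation.Nullary using (¬_)
open import Relation.Binary.PropositionalEquality
  using (_≡_; _≢_; refl; sym; trans; cong; cong₂; isEquivalence; module ≡-Reasoning)

module _ {A : Set} {_∙_ : A → A → A} {ε : A} {_⁻¹ : A → A} where

  zipWith-isAbelianGroup : IsAbelianGroup _≡_ _∙_ ε _⁻¹ → ∀ {k} →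
                           IsAbelianGroup _≡_ (zipWith {n = k} _∙_) (replicate k ε) (map _⁻¹)
  zipWith-isAbelianGroup G = record
    { isGroup = record
      { isMonoid = record
        { isSemigroup = record
          { isMagma = record { isEquivalence = isEquivalence ; ∙-cong = cong₂ _ }
          ; assoc   = zipWith-assoc assoc
          }
        ; identity = zipWith-identityˡ identityˡ , zipWith-identityʳ identityʳ
        }
      ; inverse = zipWith-inverseˡ inverseˡ , zipWith-inverseʳ inverseʳ
      ; ⁻¹-cong = cong (map _⁻¹)
      }
    ; comm = zipWith-comm comm
    }
    where open IsAbelianGroup G using (assoc; identityˡ; identityʳ; inverseˡ; inverseʳ; comm)

module _ (n : ℕ) .{{_ : NonZero n}} where
  open ≡-Reasoning

  [m%n+o]%n≡[m+o]%n : ∀ m o → (m % n + o) % n ≡ (m + o) % n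
  [m%n+o]%n≡[m+o]%n m o = begin
    (m % n + o) % n         ≡⟨ %-distribˡ-+ (m % n) o n ⟩
    (m % n % n + o % n) % n ≡⟨ cong (λ t → (t + o % n) % n) (m%n%n≡m%n m n) ⟩
    (m % n + o % n) % n     ≡⟨ %-distribˡ-+ m o n ⟨
    (m + o) % n             ∎

  [m+o%n]%n≡[m+o]%n : ∀ m o → (m + o % n) % n ≡ (m + o) % n
  [m+o%n]%n≡[m+o]%n m o = begin
    (m + o % n) % n ≡⟨ cong (_% n) (+-comm m (o % n)) ⟩
    (o % n + m) % n ≡⟨ [m%n+o]%n≡[m+o]%n o m ⟩
    (o + m) % n     ≡⟨ cong (_% n) (+-comm o m) ⟩
    (m + o) % n     ∎

module _ {p : ℕ} .{{_ : NonZero p}} where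
  open ≡-Reasoning

  toℕ-mod : ∀ m → toℕ (m mod p) ≡ m % p
  toℕ-mod m = toℕ-fromℕ< _

  toℕ-0ₚ : toℕ (0ₚ {p}) ≡ 0
  toℕ-0ₚ = trans (toℕ-mod 0) (m<n⇒m%n≡m (>-nonZero⁻¹ p))

  +ₚ-comm : ∀ (i j : Fin p) → i +ₚ j ≡ j +ₚ i
  +ₚ-comm i j = cong (_mod p) (+-comm (toℕ i) (toℕ j))

  +ₚ-assoc : ∀ (i j l : Fin p) → (i +ₚ j) +ₚ l ≡ i +ₚ (j +ₚ l)
  +ₚ-assoc i j l = toℕ-injective (begin
    toℕ ((i +ₚ j) +ₚ l)                  ≡⟨ toℕ-mod _ ⟩
    (toℕ (i +ₚ j) + toℕ l) % p           ≡⟨ cong (λ t → (t + toℕ l) % p) (toℕ-mod _) ⟩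
    ((toℕ i + toℕ j) % p + toℕ l) % p    ≡⟨ [m%n+o]%n≡[m+o]%n p _ _ ⟩
    (toℕ i + toℕ j + toℕ l) % p          ≡⟨ cong (_% p) (+-assoc (toℕ i) (toℕ j) (toℕ l)) ⟩
    (toℕ i + (toℕ j + toℕ l)) % p        ≡⟨ [m+o%n]%n≡[m+o]%n p _ _ ⟨
    (toℕ i + (toℕ j + toℕ l) % p) % p    ≡⟨ cong (λ t → (toℕ i + t) % p) (toℕ-mod _) ⟨
    (toℕ i + toℕ (j +ₚ l)) % p           ≡⟨ toℕ-mod _ ⟨
    toℕ (i +ₚ (j +ₚ l))                  ∎)

  +ₚ-identityʳ : ∀ (i : Fin p) → i +ₚ 0ₚ ≡ i
  +ₚ-identityʳ i = toℕ-injective (begin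
    toℕ (i +ₚ 0ₚ)             ≡⟨ toℕ-mod _ ⟩
    (toℕ i + toℕ (0ₚ {p})) % p ≡⟨ cong (λ t → (toℕ i + t) % p) toℕ-0ₚ ⟩
    (toℕ i + 0) % p           ≡⟨ cong (_% p) (+-identityʳ (toℕ i)) ⟩
    toℕ i % p                 ≡⟨ m<n⇒m%n≡m (toℕ<n i) ⟩
    toℕ i                     ∎)

  +ₚ-inverseʳ : ∀ (i : Fin p) → i +ₚ (-ₚ i) ≡ 0ₚ
  +ₚ-inverseʳ i = toℕ-injective (begin
    toℕ (i +ₚ (-ₚ i))                ≡⟨ toℕ-mod _ ⟩
    (toℕ i + toℕ (-ₚ i)) % p         ≡⟨ cong (λ t → (toℕ i + t) % p) (toℕ-mod _) ⟩
    (toℕ i + (p ∸ toℕ i) % p) % p    ≡⟨ [m+o%n]%n≡[m+o]%n p _ _ ⟩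
    (toℕ i + (p ∸ toℕ i)) % p        ≡⟨ cong (_% p) (+-comm (toℕ i) _) ⟩
    ((p ∸ toℕ i) + toℕ i) % p        ≡⟨ cong (_% p) (m∸n+n≡m (<⇒≤ (toℕ<n i))) ⟩
    p % p                            ≡⟨ n%n≡0 p ⟩
    0                                ≡⟨ toℕ-0ₚ ⟨
    toℕ (0ₚ {p})                     ∎)

  +ₚ-isAbelianGroup : IsAbelianGroup _≡_ _+ₚ_ 0ₚ -ₚ_
  +ₚ-isAbelianGroup = record
    { isGroup = record
      { isMonoid = record
        { isSemigroup = record
          { isMagma = record { isEquivalence = isEquivalence ; ∙-cong = cong₂ _ }
          ; assoc   = +ₚ-assoc
          }
        ; identity = comm∧idʳ⇒id +ₚ-comm +ₚ-identityʳ
        }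
      ; inverse = comm∧invʳ⇒inv +ₚ-comm +ₚ-inverseʳ
      ; ⁻¹-cong = cong -ₚ_
      }
    ; comm = +ₚ-comm
    }

  ℤ^-abelianGroup : ℕ → AbelianGroup 0ℓ 0ℓ
  ℤ^-abelianGroup k = record { isAbelianGroup = zipWith-isAbelianGroup +ₚ-isAbelianGroup {k} }

module _ {a ℓ} (G : AbelianGroup a ℓ) where
  open AbelianGroup G
  open AbelianGroupProperties G using (xyx⁻¹≈y)
  open import Relation.Binary.Reasoning.Setoid setoid

  x∙[y-x]≈y : ∀ x y → x ∙ (y - x) ≈ y
  x∙[y-x]≈y x y = begin
    x ∙ (y ∙ x ⁻¹)  ≈⟨ assoc x y (x ⁻¹) ⟨
    x ∙ y ∙ x ⁻¹    ≈⟨ xyx⁻¹≈y x y ⟩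
    y               ∎

lemma3 : (p : ℕ) .{{_ : NonZero p}} → Prime p → (k : ℕ) → k ≥ 1 →
         (x y z : ℕ) → ∣V∣ x y z ≡ p ^ k →
         (f : Vtx x y z → ℤ^ p k) → IsRainbow f →
         (a b : ℤ^ p k) → f s₁ ≡ a → f s₂ ≡ 𝟘 → f s₃ ≡ b →
         (¬ ∃ λ (u : Fin x) → f (leafX u) ≡ b ⊖ a)
         × (¬ ∃ λ (w : Fin z) → f (leafZ w) ≡ a ⊖ b)
         × (¬ ∃₂ λ (u : Fin x) (v : Fin y) → f (leafY v) ≡ f (leafX u) ⊕ a)
         × (¬ ∃₂ λ (w : Fin z) (v : Fin y) → f (leafY v) ≡ f (leafZ w) ⊕ b)
         × (¬ ∃₂ λ (w : Fin z) (u : Fin x) → f (leafX u) ≡ f (leafZ w) ⊕ (b ⊖ a))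
lemma3 p _ k _ x y z _ f (_ , label-injective) a b refl f[s₂]≡𝟘 refl =
    (λ (u , eq) → distinct {eX u} {e₂₃} (λ ())
      (trans (cong (a ⊕_) eq) (trans (x∙[y-x]≈y G a b) (sym label-e₂₃))))
  , (λ (w , eq) → distinct {eZ w} {e₁₂} (λ ())
      (trans (cong (b ⊕_) eq) (trans (x∙[y-x]≈y G b a) (sym label-e₁₂))))
  , (λ (u , v , eq) → distinct {eX u} {eY v} (λ ())
      (trans (comm a _) (trans (sym eq) (sym (label-eY v)))))
  , (λ (w , v , eq) → distinct {eZ w} {eY v} (λ ())
      (trans (comm b _) (trans (sym eq) (sym (label-eY v)))))
  , (λ (w , u , eq) → distinct {eX u} {eZ w} (λ ()) (begin
      a ⊕ f (leafX u)             ≡⟨ cong (a ⊕_) eq ⟩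
      a ⊕ (f (leafZ w) ⊕ (b ⊖ a)) ≡⟨ x∙yz≈y∙xz a (f (leafZ w)) (b ⊖ a) ⟩
      f (leafZ w) ⊕ (a ⊕ (b ⊖ a)) ≡⟨ cong (f (leafZ w) ⊕_) (x∙[y-x]≈y G a b) ⟩
      f (leafZ w) ⊕ b             ≡⟨ comm _ b ⟩
      b ⊕ f (leafZ w)             ∎))
  where
  G = ℤ^-abelianGroup {p} k
  open AbelianGroup G using (comm; identityˡ; identityʳ)
  open CommutativeSemigroupProperties (AbelianGroup.commutativeSemigroup G) using (x∙yz≈y∙xz)
  open ≡-Reasoning

  distinct : ∀ {e e′} → e ≢ e′ → edgeLabel f e ≢ edgeLabel f e′
  distinct e≢e′ = e≢e′ ∘ label-injective

  label-e₁₂ : edgeLabel f e₁₂ ≡ a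
  label-e₁₂ = trans (cong (a ⊕_) f[s₂]≡𝟘) (identityʳ a)

  label-e₂₃ : edgeLabel f e₂₃ ≡ b
  label-e₂₃ = trans (cong (_⊕ b) f[s₂]≡𝟘) (identityˡ b)

  label-eY : ∀ v → edgeLabel f (eY v) ≡ f (leafY v)
  label-eY v = trans (cong (_⊕ f (leafY v)) f[s₂]≡𝟘) (identityˡ _)
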